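{- For every condition $b:S\to\mathbb{B}$, loop body $P:S\to(E,S)\mathsf{itree}$, states $s,s'\in S$ and event list $tr$: $$(\mathsf{while}\ b\ P)(s)\xrightarrow{tr}\mathsf{Ret}\,s' \iff (\neg b(s)\wedge s=s'\wedge tr=[])\ \vee\ \big(b(s)\wedge (b,s)\vdash P\xrightarrow{tr}s'\wedge\neg b(s')\big).$$
   Context: Fix a type $E$ of events. $(E,S)\mathsf{itree}$ is the codatatype with constructors $\mathsf{Ret}\,r$ ($r\in S$), $\mathsf{Sil}\,P$ written $\tau P$, and $\mathsf{Vis}\,F$ with $F:E\rightharpoonup(E,S)\mathsf{itree}$ a partial function. Bind: $\mathsf{Ret}\,r\mathbin{>\!\!>\!\!=}K=K\,r$, $\tau P'\mathbin{>\!\!>\!\!=}K=\tau(P'\mathbin{>\!\!>\!\!=}K)$, $\mathsf{Vis}\,F\mathbin{>\!\!>\!\!=}K=\mathsf{Vis}(\lambda e\in\mathrm{dom}(F)\bullet F(e)\mathbin{>\!\!>\!\!=}K)$. The loop $\mathsf{while}\ b\ P:S\to(E,S)\mathsf{itree}$ is defined corecursively by $\mathsf{while}\ b\ P\ s=$ if $b(s)$ then $\tau(P(s)\mathbin{>\!\!>\!\!=}\mathsf{while}\ b\ P)$ else $\mathsf{Ret}\,s$. Transition relation $P\xrightarrow{tr}P'$: least relation with $P\xrightarrow{[]}P$; $P\xrightarrow{tr}P'\Rightarrow\tau P\xrightarrow{tr}P'$; $e\in\mathrm{dom}(F)\wedge F(e)\xrightarrow{tr}P'\Rightarrow\mathsf{Vis}\,F\xrightarrow{e\#tr}P'$.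 Iteration chains: $s\vdash P\leadsto^{chn}s'$, with $chn$ a list of (event list, state) pairs, is the least relation with $s\vdash P\leadsto^{[]}s$, and if $P(s)\xrightarrow{tr}\mathsf{Ret}\,s_0$ and $s_0\vdash P\leadsto^{chn}s_1$ then $s\vdash P\leadsto^{(tr,s_0)\#chn}s_1$. For a chain, $\mathit{states}(chn)$ is the set of its second components and $\mathit{trace}(chn)$ the concatenation of its first components. Partial iteration: $(b,s)\vdash P\xrightarrow{tr}s'$ holds iff there exist $chn,s_0,tr_0$ with $b(s)$, $s\vdash P\leadsto^{chn}s_0$, $b(t)$ for all $t\in\mathit{states}(chn)$, $P(s_0)\xrightarrow{tr_0}\mathsf{Ret}\,s'$, and $tr=\mathit{trace}(chn)\mathbin{@}tr_0$. -}

module Defs where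

open import Data.Bool using (Bool; true; false; if_then_else_)
open import Data.Maybe using (Maybe; just; nothing) renaming (map to mapMaybe)
open import Data.List using (List; []; _∷_; _++_; map; concat)
open import Data.Product using (Σ; _×_; _,_; proj₁; proj₂)
open import Data.Sum using (_⊎_; inj₁; inj₂)
open import Data.Unit using (⊤; tt)
open import Relation.Binary.PropositionalEquality using (_≡_)

-- Interaction trees  (E,S) itree.
-- `--guardedness`/`--sized-types` are not available, so the codatatype is
-- represented by its standard presentation as a pointed coalgebra of the
-- one-layer functor: a tree is a state space St, a step map
-- St → ITreeF E S St (the "out"/unfold of the codatatype) and a root.
-- Unfolding from the root produces exactly the (possibly infinite) tree.
-- A partial function E ⇀ X is E → Maybe X (dom F = {e | F e ≡ just _}).

data ITreeF (E S X : Set) : Set where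
  Ret : S → ITreeF E S X
  Sil : X → ITreeF E S X
  Vis : (E → Maybe X) → ITreeF E S X

record ITree (E S : Set) : Set₁ where
  constructor itree
  field
    St   : Set
    step : St → ITreeF E S St
    root : St
open ITree public

module _ {E S : Set} where

  ret : S → ITree E S
  ret r = itree ⊤ (λ _ → Ret r) tt

  -- Bind:  Ret r >>= K = K r,  τ P' >>= K = τ (P' >>= K),
  --        Vis F >>= K = Vis (λ e ∈ dom F • F e >>= K).
  _>>=_ : ITree E S → (S → ITree E S) → ITree E S
  P >>= K = itree (St P ⊎ Σ S (λ r → St (K r))) stp (inj₁ (root P))
    where
    kont : (r : S) → ITreeF E S (St (K r)) → ITreeF E S (St P ⊎ Σ S (λ r → St (K r)))
    kont r (Ret s) = Ret s
    kont r (Sil y) = Sil (inj₂ (r , y))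
    kont r (Vis F) = Vis (λ e → mapMaybe (λ y → inj₂ (r , y)) (F e))
    stp : St P ⊎ Σ S (λ r → St (K r)) → ITreeF E S (St P ⊎ Σ S (λ r → St (K r)))
    stp (inj₁ x) with step P x
    ... | Ret r = kont r (step (K r) (root (K r)))
    ... | Sil x' = Sil (inj₁ x')
    ... | Vis F = Vis (λ e → mapMaybe inj₁ (F e))
    stp (inj₂ (r , y)) = kont r (step (K r) y)

  -- The loop:  while b P s = if b s then τ (P s >>= while b P) else Ret s.
  -- Being corecursive, it is given as the coalgebra whose states are
  --   loopStart s   (the tree  while b P s)   and
  --   inBody s₀ x   (the tree  Q >>= while b P, Q the subtree of P s₀ at x),
  -- the unfolding of which is exactly the paper's corecursive equation.
  module _ (b : S → Bool) (P : S → ITree E S) where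

    data LoopSt : Set where
      loopStart : S → LoopSt
      inBody    : (s₀ : S) → St (P s₀) → LoopSt

    loopStep : LoopSt → ITreeF E S LoopSt
    loopStep (loopStart s) =
      if b s then Sil (inBody s (root (P s))) else Ret s
    loopStep (inBody s₀ x) with step (P s₀) x
    ... | Ret s' = if b s' then Sil (inBody s' (root (P s'))) else Ret s'
    ... | Sil x' = Sil (inBody s₀ x')
    ... | Vis F  = Vis (λ e → mapMaybe (inBody s₀) (F e))

  while : (S → Bool) → (S → ITree E S) → S → ITree E S
  while b P s = itree (LoopSt b P) (loopStep b P) (loopStart s)

  -- Transition relation  P -[tr]-> Ret s'  (the paper's least relation,
  -- for targets of the form Ret s', the only instance used here),
  -- defined on the nodes of a tree.

  data Steps {X : Set} (stp : X → ITreeF E S X) : X → List E → S → Set where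
    done : ∀ {x s} → stp x ≡ Ret s → Steps stp x [] s
    sil  : ∀ {x x' tr s} → stp x ≡ Sil x' → Steps stp x' tr s → Steps stp x tr s
    vis  : ∀ {x F e x' tr s} → stp x ≡ Vis F → F e ≡ just x' →
           Steps stp x' tr s → Steps stp x (e ∷ tr) s

  _⟶[_]Ret_ : ITree E S → List E → S → Set
  P ⟶[ tr ]Ret s = Steps (step P) (root P) tr s

  Chain : Set
  Chain = List (List E × S)

  data _⊢_↝[_]_ : S → (S → ITree E S) → Chain → S → Set₁ where
    nil  : ∀ {s P} → s ⊢ P ↝[ [] ] s
    cons : ∀ {s P tr s₀ chn s₁} → P s ⟶[ tr ]Ret s₀ → s₀ ⊢ P ↝[ chn ] s₁ →
           s ⊢ P ↝[ (tr , s₀) ∷ chn ] s₁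

  states : Chain → List S
  states chn = map proj₂ chn

  trace : Chain → List E
  trace chn = concat (map proj₁ chn)

  PartialIter : (S → Bool) → S → (S → ITree E S) → List E → S → Set₁
  PartialIter b s P tr s' =
    Σ Chain λ chn → Σ S λ s₀ → Σ (List E) λ tr₀ →
      b s ≡ true × s ⊢ P ↝[ chn ] s₀
      × (∀ t → t ∈ states chn → b t ≡ true)
      × P s₀ ⟶[ tr₀ ]Ret s' × tr ≡ trace chn ++ tr₀
    where open import Data.List.Membership.Propositional using (_∈_)

-- Both sides are compared with the big-step semantics of the loop: exit when b fails,
-- otherwise run the body and then the loop again. A body run followed by a loop run
-- composes to a run of the loop tree. Conversely, every transition of the loop tree
-- preserves the invariant that a loop-start node starts a big-step derivation and a node
-- inside the body started at s₀ has a remaining body run to a state that starts one.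
-- Unrolling a big-step derivation gives exactly a partial iteration (body runs through
-- states satisfying b, then a last body run) ending in a state that fails b.
module Submission where

open import Defs
open import Level using (Level)
open import Data.Bool using (Bool; true; false)
open import Data.List using (List; []; _∷_; _++_)
open import Data.List.Properties using (++-identityʳ; ++-assoc)
open import Data.List.Membership.Propositional using (_∈_)
open import Data.List.Relation.Unary.Any using (here; there)
open import Data.Maybe using (just) renaming (map to mapMaybe)
open import Data.Product using (_×_; _,_)
open import Data.Sum using (_⊎_; inj₁; inj₂)
open import Function.Bundles using (_⇔_; mk⇔)
open import Function.Construct.Composition using (_⇔-∘_)
open import Relation.Binary.PropositionalEquality using (_≡_; refl; sym; trans; cong; subst)

module _ {E S X : Set} {stp : X → ITreeF E S X} where

  Steps-ind : ∀ {ℓ : Level} (Q : X → List E → S → Set ℓ) →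
    (∀ {x s} → stp x ≡ Ret s → Q x [] s) →
    (∀ {x x' tr s} → stp x ≡ Sil x' → Q x' tr s → Q x tr s) →
    (∀ {x F e x' tr s} → stp x ≡ Vis F → F e ≡ just x' → Q x' tr s → Q x (e ∷ tr) s) →
    ∀ {x tr s} → Steps stp x tr s → Q x tr s
  Steps-ind Q on-done on-sil on-vis (done eq)       = on-done eq
  Steps-ind Q on-done on-sil on-vis (sil eq run)    = on-sil eq (Steps-ind Q on-done on-sil on-vis run)
  Steps-ind Q on-done on-sil on-vis (vis eq fe run) = on-vis eq fe (Steps-ind Q on-done on-sil on-vis run)

  Steps-resp-step : ∀ {x y tr s} → stp x ≡ stp y → Steps stp y tr s → Steps stp x tr s
  Steps-resp-step eq (done e)       = done (trans eq e)
  Steps-resp-step eq (sil e run)    = sil (trans eq e) run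
  Steps-resp-step eq (vis e fe run) = vis (trans eq e) fe run

module Loop {E S : Set} (b : S → Bool) (P : S → ITree E S) where

  L : LoopSt b P → ITreeF E S (LoopSt b P)
  L = loopStep b P

  infix 4 _⇓[_]_

  data _⇓[_]_ : S → List E → S → Set where
    exit    : ∀ {s} → b s ≡ false → s ⇓[ [] ] s
    iterate : ∀ {s tr₁ s₁ tr₂ s'} → b s ≡ true → P s ⟶[ tr₁ ]Ret s₁ → s₁ ⇓[ tr₂ ] s' →
              s ⇓[ tr₁ ++ tr₂ ] s'

  ⇓-exit : ∀ {s tr s'} → s ⇓[ tr ] s' → b s' ≡ false
  ⇓-exit (exit bf)          = bf
  ⇓-exit (iterate _ _ rest) = ⇓-exit rest

  loopStep-exit : ∀ {s} → b s ≡ false → L (loopStart s) ≡ Ret s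
  loopStep-exit bf rewrite bf = refl

  loopStep-enter : ∀ {s} → b s ≡ true → L (loopStart s) ≡ Sil (inBody s (root (P s)))
  loopStep-enter bt rewrite bt = refl

  loopStep-ret : ∀ {s₀ x s₁} → step (P s₀) x ≡ Ret s₁ → L (inBody s₀ x) ≡ L (loopStart s₁)
  loopStep-ret eq rewrite eq = refl

  loopStep-sil : ∀ {s₀ x x'} → step (P s₀) x ≡ Sil x' → L (inBody s₀ x) ≡ Sil (inBody s₀ x')
  loopStep-sil eq rewrite eq = refl

  loopStep-vis : ∀ {s₀ x F} → step (P s₀) x ≡ Vis F →
                 L (inBody s₀ x) ≡ Vis (λ e → mapMaybe (inBody s₀) (F e))
  loopStep-vis eq rewrite eq = refl

  body-then-loop : ∀ {s₀ x tr₁ s₁ tr₂ s'} → Steps (step (P s₀)) x tr₁ s₁ →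
                   Steps L (loopStart s₁) tr₂ s' → Steps L (inBody s₀ x) (tr₁ ++ tr₂) s'
  body-then-loop (done eq)       loop = Steps-resp-step (loopStep-ret eq) loop
  body-then-loop (sil eq run)    loop = sil (loopStep-sil eq) (body-then-loop run loop)
  body-then-loop (vis eq fe run) loop = vis (loopStep-vis eq) (cong (mapMaybe _) fe) (body-then-loop run loop)

  ⇓⇒Steps : ∀ {s tr s'} → s ⇓[ tr ] s' → Steps L (loopStart s) tr s'
  ⇓⇒Steps (exit bf)             = done (loopStep-exit bf)
  ⇓⇒Steps (iterate bt run rest) = sil (loopStep-enter bt) (body-then-loop run (⇓⇒Steps rest))

  data BodyThen⇓ (s₀ : S) (x : St (P s₀)) : List E → S → Set where
    _▹_ : ∀ {tr₁ s₁ tr₂ s'} → Steps (step (P s₀)) x tr₁ s₁ → s₁ ⇓[ tr₂ ] s' →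
          BodyThen⇓ s₀ x (tr₁ ++ tr₂) s'

  Completes : LoopSt b P → List E → S → Set
  Completes (loopStart s)  = _⇓[_]_ s
  Completes (inBody s₀ x) = BodyThen⇓ s₀ x

  Completes-done : ∀ {y s'} → L y ≡ Ret s' → Completes y [] s'
  Completes-done {loopStart s} Ly≡ with b s in bs
  Completes-done {loopStart s} refl | false = exit bs
  Completes-done {inBody s₀ x} Ly≡ with step (P s₀) x in eq
  ... | Ret s₁ with b s₁ in bs
  Completes-done {inBody s₀ x} refl | Ret s₁ | false = done eq ▹ exit bs

  Completes-sil : ∀ {y y' tr s'} → L y ≡ Sil y' → Completes y' tr s' → Completes y tr s'
  Completes-sil {loopStart s} Ly≡ _ with b s in bs
  Completes-sil {loopStart s} refl (run ▹ rest) | true = iterate bs run rest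
  Completes-sil {inBody s₀ x} Ly≡ _ with step (P s₀) x in eq
  ... | Ret s₁ with b s₁ in bs
  Completes-sil {inBody s₀ x} refl (run ▹ rest) | Ret s₁ | true = done eq ▹ iterate bs run rest
  Completes-sil {inBody s₀ x} refl (run ▹ rest) | Sil x' = sil eq run ▹ rest

  Completes-vis : ∀ {y F e y' tr s'} → L y ≡ Vis F → F e ≡ just y' →
                  Completes y' tr s' → Completes y (e ∷ tr) s'
  Completes-vis {loopStart s} Ly≡ _ _ with b s
  Completes-vis {loopStart s} () _ _ | true
  Completes-vis {loopStart s} () _ _ | false
  Completes-vis {inBody s₀ x} Ly≡ _ _ with step (P s₀) x in eq
  ... | Ret s₁ with b s₁
  Completes-vis {inBody s₀ x} () _ _ | Ret s₁ | true
  Completes-vis {inBody s₀ x} () _ _ | Ret s₁ | false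
  Completes-vis {inBody s₀ x} {e = ev} refl _ _ | Vis G with G ev in g
  Completes-vis {inBody s₀ x} refl refl (run ▹ rest) | Vis G | just x' = vis eq g run ▹ rest

  Steps⇒⇓ : ∀ {s tr s'} → Steps L (loopStart s) tr s' → s ⇓[ tr ] s'
  Steps⇒⇓ = Steps-ind Completes Completes-done Completes-sil Completes-vis

  while⇔⇓ : ∀ {s tr s'} → (while b P s ⟶[ tr ]Ret s') ⇔ (s ⇓[ tr ] s')
  while⇔⇓ = mk⇔ Steps⇒⇓ ⇓⇒Steps

  partialIter-cons : ∀ {s tr₁ s₁ tr₂ s'} → b s ≡ true → P s ⟶[ tr₁ ]Ret s₁ →
                     PartialIter b s₁ P tr₂ s' → PartialIter b s P (tr₁ ++ tr₂) s'
  partialIter-cons {tr₁ = tr₁} {s₁} bt run (chn , s₀ , tr₀ , bt₁ , chain , all-b , last , refl) =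
    (tr₁ , s₁) ∷ chn , s₀ , tr₀ , bt , cons run chain , all-b′ , last , sym (++-assoc tr₁ _ tr₀)
    where
    all-b′ : ∀ t → t ∈ states ((tr₁ , s₁) ∷ chn) → b t ≡ true
    all-b′ t (here refl) = bt₁
    all-b′ t (there t∈) = all-b t t∈

  iterate⇒partialIter : ∀ {s tr₁ s₁ tr₂ s'} → b s ≡ true → P s ⟶[ tr₁ ]Ret s₁ →
                        s₁ ⇓[ tr₂ ] s' → PartialIter b s P (tr₁ ++ tr₂) s'
  iterate⇒partialIter {tr₁ = tr₁} bt run (exit _) =
    [] , _ , tr₁ , bt , nil , (λ _ ()) , run , ++-identityʳ tr₁
  iterate⇒partialIter bt run (iterate bt₁ run₁ rest) =
    partialIter-cons bt run (iterate⇒partialIter bt₁ run₁ rest)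

  chain⇒⇓ : ∀ {s chn s₀ tr₀ s'} → b s ≡ true → s ⊢ P ↝[ chn ] s₀ →
            (∀ t → t ∈ states chn → b t ≡ true) → P s₀ ⟶[ tr₀ ]Ret s' → b s' ≡ false →
            s ⇓[ trace chn ++ tr₀ ] s'
  chain⇒⇓ {tr₀ = tr₀} bt nil _ last bf =
    subst (λ tr → _ ⇓[ tr ] _) (++-identityʳ tr₀) (iterate bt last (exit bf))
  chain⇒⇓ {tr₀ = tr₀} bt (cons {tr = tr} {chn = chn} run chain) all-b last bf =
    subst (λ tr′ → _ ⇓[ tr′ ] _) (sym (++-assoc tr (trace chn) tr₀))
      (iterate bt run (chain⇒⇓ (all-b _ (here refl)) chain (λ t t∈ → all-b t (there t∈)) last bf))

  Exit⊎PartialIter : S → List E → S → Set₁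
  Exit⊎PartialIter s tr s' =
    (b s ≡ false × s ≡ s' × tr ≡ []) ⊎ (b s ≡ true × PartialIter b s P tr s' × b s' ≡ false)

  ⇓⇔exit⊎partialIter : ∀ {s tr s'} → (s ⇓[ tr ] s') ⇔ Exit⊎PartialIter s tr s'
  ⇓⇔exit⊎partialIter = mk⇔ to from
    where
    to : ∀ {s tr s'} → s ⇓[ tr ] s' → Exit⊎PartialIter s tr s'
    to (exit bf)             = inj₁ (bf , refl , refl)
    to (iterate bt run rest) = inj₂ (bt , iterate⇒partialIter bt run rest , ⇓-exit rest)
    from : ∀ {s tr s'} → Exit⊎PartialIter s tr s' → s ⇓[ tr ] s'
    from (inj₁ (bf , refl , refl)) = exit bf
    from (inj₂ (_ , (_ , _ , _ , bt , chain , all-b , last , refl) , bf)) = chain⇒⇓ bt chain all-b last bf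

theorem3p15 : {E S : Set} (b : S → Bool) (P : S → ITree E S) (s s' : S) (tr : List E) →
    (while b P s ⟶[ tr ]Ret s')
      ⇔ ((b s ≡ false × s ≡ s' × tr ≡ [])
         ⊎ (b s ≡ true × PartialIter b s P tr s' × b s' ≡ false))
theorem3p15 b P s s' tr = ⇓⇔exit⊎partialIter ⇔-∘ while⇔⇓
  where open Loop b P
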